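{- Let $G$ be a finite directed graph and $R\subseteq V(G)$, and let $\{F_i\}_{i\in I}$ be the maximal faces of $\mathrm{DT}_R(G)$. Call a vertex $v\in V(G)$ a left vertex if there is a vertex $r$ such that in every $F_i$ the tree of $F_i$ containing $v$ has root $r$ and the directed path from $r$ to $v$ in $F_i$ is the same for all $i\in I$; all other vertices are right vertices. Then every edge $(x\rightarrow y)\in\bigcup_{i\in I}F_i$ having one endpoint a left vertex and the other a right vertex is nice in $\mathrm{DT}_R(G)$.
   Context: A directed forest in a directed graph $G$ is a set $F$ of edges of $G$ such that at most one edge of $F$ is directed to each vertex and $F$ contains no directed cycle; equivalently, a disjoint union of directed trees with all edges oriented away from their roots. The roots of $F$ are the vertices of $G$ with no edge of $F$ directed to them. $\mathrm{DT}(G)$ is the simplicial complex with vertex set $E(G)$ whose faces are the edge sets of directed forests of $G$. For $R\subseteq V(G)$, $\mathrm{DT}_R(G)\subseteq\mathrm{DT}(G)$ is the subcomplex generated by the directed forests whose set of roots is exactly $R$; these forests are the maximal faces of $\mathrm{DT}_R(G)$. For a subcomplex $\Delta$ of $\mathrm{DT}(G)$, an edge $(x\rightarrow y)$ of $G$ is nice in $\Delta$ if (i) there is an edge $(z\rightarrow y)$ which is a vertex of $\Delta$ with $z\neq x$, and (ii) for every forest $F\in\Delta$ containing no edge directed to $y$, $F\cup\{(x\rightarrow y)\}$ is a directed forest and belongs to $\Delta$. -}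

module Defs where

open import Data.Nat using (ℕ)
open import Data.Fin using (Fin; _≟_)
open import Data.Bool using (Bool; true; false; _∨_; _∧_)
open import Data.List using (List; []; _∷_)
open import Data.Product using (Σ; _×_; ∃; _,_)
open import Data.Sum using (_⊎_)
open import Relation.Nullary using (¬_)
open import Relation.Nullary.Decidable using (⌊_⌋)
open import Relation.Binary.PropositionalEquality using (_≡_)
open import Relation.Binary.Construct.Closure.Transitive using (TransClosure)

-- A finite (simple) directed graph on vertex set Fin n is given by its
-- edge relation: E x y ≡ true iff (x → y) is an edge (loops allowed).
Graph : ℕ → Set
Graph n = Fin n → Fin n → Bool

EdgeSet : ℕ → Set
EdgeSet n = Fin n → Fin n → Bool

VSet : ℕ → Set
VSet n = Fin n → Bool

_⊆E_ : ∀ {n} → EdgeSet n → EdgeSet n → Set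
F ⊆E F′ = ∀ x y → F x y ≡ true → F′ x y ≡ true

insertEdge : ∀ {n} → EdgeSet n → Fin n → Fin n → EdgeSet n
insertEdge F x y a b = F a b ∨ (⌊ a ≟ x ⌋ ∧ ⌊ b ≟ y ⌋)

IsRoot : ∀ {n} → EdgeSet n → Fin n → Set
IsRoot F v = ∀ u → F u v ≡ false

IsDirectedForest : ∀ {n} → Graph n → EdgeSet n → Set
IsDirectedForest {n} G F =
  (F ⊆E G)
  × (∀ x x′ y → F x y ≡ true → F x′ y ≡ true → x ≡ x′)
  × (∀ v → ¬ TransClosure (λ a b → F a b ≡ true) v v)

RootsExactly : ∀ {n} → EdgeSet n → VSet n → Set
RootsExactly F R = ∀ v → (R v ≡ true → IsRoot F v) × (IsRoot F v → R v ≡ true)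

-- Directed forests of G with root set exactly R: the generators
-- (= maximal faces) of DT_R(G).
IsMaxFace : ∀ {n} → Graph n → VSet n → EdgeSet n → Set
IsMaxFace G R F = IsDirectedForest G F × RootsExactly F R

InDTR : ∀ {n} → Graph n → VSet n → EdgeSet n → Set
InDTR {n} G R F = Σ (EdgeSet n) λ F′ → IsMaxFace G R F′ × (F ⊆E F′)

IsNice : ∀ {n} → Graph n → VSet n → Fin n → Fin n → Set
IsNice {n} G R x y =
  (∃ λ (z : Fin n) → ¬ (z ≡ x) × InDTR G R (λ a b → ⌊ a ≟ z ⌋ ∧ ⌊ b ≟ y ⌋))
  × (∀ (F : EdgeSet n) → InDTR G R F → IsRoot F y →
       IsDirectedForest G (insertEdge F x y) × InDTR G R (insertEdge F x y))

-- A directed path in F given by its vertex sequence: PathFromTo F r vs v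
-- means r, vs is a sequence of vertices starting at r and ending at v
-- with consecutive vertices joined by edges of F (vs = [] means v = r).
PathFromTo : ∀ {n} → EdgeSet n → Fin n → List (Fin n) → Fin n → Set
PathFromTo F r [] v = r ≡ v
PathFromTo F r (u ∷ us) v = (F r u ≡ true) × PathFromTo F u us v

-- Left vertex: there is r and a fixed directed path p such that in every
-- maximal face F of DT_R(G), r is a root of F (so r is the root of the
-- tree of F containing v) and p is the path from r to v in F.
IsLeft : ∀ {n} → Graph n → VSet n → Fin n → Set
IsLeft {n} G R v =
  ∃ λ (r : Fin n) → ∃ λ (p : List (Fin n)) →
    ∀ (F : EdgeSet n) → IsMaxFace G R F → IsRoot F r × PathFromTo F r p v

{-# OPTIONS --safe #-}
-- Let x → y lie in the maximal face F₀.  If y is left, its fixed path ends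
-- with the edge from its parent, which is x in F₀; hence x is left as well,
-- and only the case "x left, y right" remains.
-- (i) Some maximal face omits x → y, since otherwise y would be left along
-- the path of x extended by y; as y ∉ R, its parent there is some z ≠ x.
-- (ii) If H ⊆ F with F maximal and y a root of H, replacing the edge of F
-- into y by x → y gives a maximal face containing H ∪ {x → y}: the roots
-- are unchanged, and a new cycle would have to enter y, which descends from
-- a root along the path of x.  That path avoids y, being also the path of x
-- in F₀, where y is a child of x.
-- Constructively, (i) needs a decision procedure: exhaustive search over
-- all edge sets, with acyclicity decided by the pigeonhole principle.
module Submission where

open import Defs
open import Level using (0ℓ)
open import Function using (_∘_; id)
open import Data.Nat using (ℕ; zero; suc; z≤n; s≤s)
open import Data.Nat.Properties using (n<1+n)
open import Data.Bool using (Bool; true; false; _∧_; if_then_else_)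
open import Data.Bool.Properties using (¬-not; not-¬) renaming (_≟_ to _≟ᵇ_)
open import Data.Fin using (Fin; zero; suc; _<_; _≟_)
open import Data.Fin.Properties using (any?; all?; pigeonhole; ¬∀⟶∃¬)
open import Data.List using ([]; _∷_; _++_; _∷ʳ_; initLast; _∷ʳ′_)
open import Data.List.Relation.Unary.All using (All; []; _∷_)
open import Data.Product using (∃; _×_; _,_; proj₁; proj₂)
open import Data.Sum using (_⊎_; inj₁; inj₂)
open import Data.Unit using (⊤; tt)
open import Data.Vec.Functional using (Vector; head; tail)
import Data.Vec.Functional as Vector
open import Data.Vec.Functional.Relation.Binary.Pointwise using (Pointwise)
open import Relation.Nullary using (¬_; Dec; yes; no; contradiction)
open import Relation.Nullary.Decidable using (⌊_⌋; map′; _×-dec_; _→-dec_)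
open import Relation.Unary using (Pred)
import Relation.Unary as U
open import Relation.Binary using (Rel; Reflexive; Decidable; _Respects_)
open import Relation.Binary.PropositionalEquality using (_≡_; _≢_; refl; sym; trans; subst)
open import Relation.Binary.Construct.Closure.Transitive
  using (TransClosure; [_]; _∷_) renaming (_∷ʳ_ to _⁺∷ʳ_)
open import Relation.Binary.Construct.Closure.ReflexiveTransitive using (Star; ε; _◅_; _◅◅_)

Searchable : (A : Set) → Rel A 0ℓ → Set₁
Searchable A _≈_ = ∀ {P : Pred A 0ℓ} → P Respects _≈_ → U.Decidable P → Dec (∃ P)

searchable-Bool : Searchable Bool _≡_
searchable-Bool _ P? with P? true | P? false
... | yes p | _     = yes (true , p)
... | no _  | yes q = yes (false , q)
... | no ¬p | no ¬q = no λ { (true , p) → ¬p p ; (false , q) → ¬q q }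

searchable-Vector : ∀ {A : Set} {_≈_ : Rel A 0ℓ} → Reflexive _≈_ → Searchable A _≈_ →
                    ∀ m → Searchable (Vector A m) (Pointwise _≈_)
searchable-Vector refl≈ search zero resp P? =
  map′ (Vector.[] ,_) (λ (v , p) → resp (λ ()) p) (P? Vector.[])
searchable-Vector {_≈_ = _≈_} refl≈ search (suc m) {P} resp P? =
  map′ (λ (a , v , p) → a Vector.∷ v , p) (λ (v , p) → head v , tail v , resp η p)
       (search resp-head λ a → searchable-Vector refl≈ search m (resp-tail a) (P? ∘ (a Vector.∷_)))
  where
  η : ∀ {v} → Pointwise _≈_ v (head v Vector.∷ tail v)
  η zero    = refl≈
  η (suc i) = refl≈
  resp-head : (λ a → ∃ λ v → P (a Vector.∷ v)) Respects _≈_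
  resp-head a≈b (v , p) = v , resp (λ { zero → a≈b ; (suc i) → refl≈ }) p
  resp-tail : ∀ a → (λ v → P (a Vector.∷ v)) Respects Pointwise _≈_
  resp-tail a v≈w = resp λ { zero → refl≈ ; (suc i) → v≈w i }

_≗E_ : ∀ {n} → EdgeSet n → EdgeSet n → Set
F ≗E F′ = ∀ a b → F a b ≡ F′ a b

searchable-EdgeSet : ∀ n → Searchable (EdgeSet n) _≗E_
searchable-EdgeSet n = searchable-Vector (λ _ → refl) (searchable-Vector refl searchable-Bool n) n

Acyclic : ∀ {A : Set} → Rel A 0ℓ → Set
Acyclic _∼_ = ∀ v → ¬ TransClosure _∼_ v v

UniquePredecessors : ∀ {A : Set} → Rel A 0ℓ → Set
UniquePredecessors _∼_ = ∀ a a′ b → a ∼ b → a′ ∼ b → a ≡ a′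

module _ {A : Set} {_∼_ : Rel A 0ℓ} where

  _◅⁺_ : ∀ {a b c} → a ∼ b → Star _∼_ b c → TransClosure _∼_ a c
  a∼b ◅⁺ ε           = [ a∼b ]
  a∼b ◅⁺ (b∼c ◅ c⇝d) = a∼b ∷ (b∼c ◅⁺ c⇝d)

  ⁺⇒⋆ : ∀ {a b} → TransClosure _∼_ a b → Star _∼_ a b
  ⁺⇒⋆ [ a∼b ]       = a∼b ◅ ε
  ⁺⇒⋆ (a∼b ∷ b⇝⁺c) = a∼b ◅ ⁺⇒⋆ b⇝⁺c

  unsnoc⁺ : ∀ {a c} → TransClosure _∼_ a c → ∃ λ b → Star _∼_ a b × b ∼ c
  unsnoc⁺ [ a∼c ] = _ , ε , a∼c
  unsnoc⁺ (a∼b ∷ b⇝⁺c) = let u , b⇝u , u∼c = unsnoc⁺ b⇝⁺c in u , a∼b ◅ b⇝u , u∼c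

  predecessor-on-cycle : ∀ {v} → TransClosure _∼_ v v → ∃ λ u → u ∼ v × TransClosure _∼_ u u
  predecessor-on-cycle cycle = let u , v⇝u , u∼v = unsnoc⁺ cycle in u , u∼v , u∼v ◅⁺ v⇝u

  successor-off-cycle : UniquePredecessors _∼_ → ∀ {a b} → a ∼ b →
                        ¬ TransClosure _∼_ a a → ¬ TransClosure _∼_ b b
  successor-off-cycle unique a∼b a-off b-cycle =
    let u , u∼b , u-cycle = predecessor-on-cycle b-cycle
    in a-off (subst (λ w → TransClosure _∼_ w w) (unique u _ _ u∼b a∼b) u-cycle)

  reachable-off-cycle : UniquePredecessors _∼_ → ∀ {a b} → Star _∼_ a b →
                        ¬ TransClosure _∼_ a a → ¬ TransClosure _∼_ b b
  reachable-off-cycle unique ε           = id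
  reachable-off-cycle unique (a∼c ◅ c⇝b) =
    reachable-off-cycle unique c⇝b ∘ successor-off-cycle unique a∼c

module _ {n : ℕ} {_∼_ : Rel (Fin n) 0ℓ} where

  WalkTo : ℕ → Fin n → Set
  WalkTo zero    v = ⊤
  WalkTo (suc k) v = ∃ λ u → u ∼ v × WalkTo k u

  walkTo? : Decidable _∼_ → ∀ k v → Dec (WalkTo k v)
  walkTo? _∼?_ zero    v = yes tt
  walkTo? _∼?_ (suc k) v = any? λ u → (u ∼? v) ×-dec walkTo? _∼?_ k u

  cycle⇒walkTo : ∀ {v} → TransClosure _∼_ v v → ∀ k → WalkTo k v
  cycle⇒walkTo cycle zero    = tt
  cycle⇒walkTo cycle (suc k) =
    let u , u∼v , u-cycle = predecessor-on-cycle cycle in u , u∼v , cycle⇒walkTo u-cycle k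

  vertices : ∀ {k v} → WalkTo k v → Fin (suc k) → Fin n
  vertices {v = v} _ zero = v
  vertices {suc k} (_ , _ , walk) (suc i) = vertices walk i

  vertices-⁺ : ∀ {k v} (walk : WalkTo k v) {i j : Fin (suc k)} → i < j →
               TransClosure _∼_ (vertices walk j) (vertices walk i)
  vertices-⁺ {suc k} (_ , u∼v , walk) {zero} {suc zero} _ = [ u∼v ]
  vertices-⁺ {suc k} (_ , u∼v , walk) {zero} {suc (suc j)} _ =
    vertices-⁺ walk {zero} {suc j} (s≤s z≤n) ⁺∷ʳ u∼v
  vertices-⁺ {suc k} (_ , _ , walk) {suc i} {suc j} (s≤s i<j) = vertices-⁺ walk i<j

  walkTo⇒cycle : ∀ {v} → WalkTo n v → ∃ λ u → TransClosure _∼_ u u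
  walkTo⇒cycle walk with pigeonhole (n<1+n n) (vertices walk)
  ... | i , j , i<j , same =
    vertices walk i ,
    subst (λ u → TransClosure _∼_ u (vertices walk i)) (sym same) (vertices-⁺ walk i<j)

  -- A cycle yields backward walks of every length, and a walk with n edges
  -- visits some vertex twice.
  acyclic? : Decidable _∼_ → Dec (Acyclic _∼_)
  acyclic? _∼?_ with any? (walkTo? _∼?_ n)
  ... | yes (v , walk) = no λ acyclic → let u , cycle = walkTo⇒cycle walk in acyclic u cycle
  ... | no ¬walk       = yes λ v cycle → ¬walk (v , cycle⇒walkTo cycle n)

Edge : ∀ {n} → EdgeSet n → Rel (Fin n) 0ℓ
Edge F a b = F a b ≡ true

module _ {n : ℕ} where

  root-¬edge : ∀ {F : EdgeSet n} {v} → IsRoot F v → ∀ u → ¬ Edge F u v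
  root-¬edge root u = not-¬ (root u)

  singleton-edge : ∀ {a b z y : Fin n} → ⌊ a ≟ z ⌋ ∧ ⌊ b ≟ y ⌋ ≡ true → a ≡ z × b ≡ y
  singleton-edge {a} {b} {z} {y} e with a ≟ z | b ≟ y
  ... | yes a≡z | yes b≡y = a≡z , b≡y
  singleton-edge () | yes _ | no _
  singleton-edge () | no _  | _

  singleton-⊆E : ∀ {F : EdgeSet n} {z y} → Edge F z y → (λ a b → ⌊ a ≟ z ⌋ ∧ ⌊ b ≟ y ⌋) ⊆E F
  singleton-⊆E {z = z} {y} z→y a b e with singleton-edge {a} {b} {z} {y} e
  ... | refl , refl = z→y

  insertEdge-edge : ∀ {F : EdgeSet n} {x y a b} →
                    Edge (insertEdge F x y) a b → Edge F a b ⊎ (a ≡ x × b ≡ y)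
  insertEdge-edge {F} {a = a} {b} e with F a b
  ... | true  = inj₁ refl
  ... | false = inj₂ (singleton-edge e)

  ⁺-⊆E : ∀ {F F′ : EdgeSet n} → F ⊆E F′ →
         ∀ {a b} → TransClosure (Edge F) a b → TransClosure (Edge F′) a b
  ⁺-⊆E F⊆F′ [ a→b ]       = [ F⊆F′ _ _ a→b ]
  ⁺-⊆E F⊆F′ (a→b ∷ b⇝⁺c) = F⊆F′ _ _ a→b ∷ ⁺-⊆E F⊆F′ b⇝⁺c

  isDirectedForest-anti : ∀ {G F F′ : EdgeSet n} →
                          F ⊆E F′ → IsDirectedForest G F′ → IsDirectedForest G F
  isDirectedForest-anti F⊆F′ (F′⊆G , unique , acyclic) =
    (λ a b → F′⊆G a b ∘ F⊆F′ a b) ,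
    (λ a a′ b a→b a′→b → unique a a′ b (F⊆F′ a b a→b) (F⊆F′ a′ b a′→b)) ,
    (λ v → acyclic v ∘ ⁺-⊆E F⊆F′)

  rootsExactly-resp : ∀ {F F′ : EdgeSet n} {R} → F ≗E F′ → RootsExactly F R → RootsExactly F′ R
  rootsExactly-resp F≗F′ roots v =
    (λ v∈R u → trans (sym (F≗F′ u v)) (proj₁ (roots v) v∈R u)) ,
    (λ root → proj₂ (roots v) λ u → trans (F≗F′ u v) (root u))

  isMaxFace-resp : ∀ {G R} → (IsMaxFace G R) Respects _≗E_
  isMaxFace-resp F≗F′ (forest , roots) =
    isDirectedForest-anti (λ a b → trans (F≗F′ a b)) forest , rootsExactly-resp F≗F′ roots

  root-off-cycle : ∀ {F : EdgeSet n} {r} → IsRoot F r → ¬ TransClosure (Edge F) r r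
  root-off-cycle {F} root cycle =
    let u , u→r , _ = predecessor-on-cycle cycle in root-¬edge {F = F} root u u→r

  isRoot? : ∀ (F : EdgeSet n) v → Dec (IsRoot F v)
  isRoot? F v = all? λ u → F u v ≟ᵇ false

  isMaxFace? : ∀ G R → U.Decidable (IsMaxFace {n} G R)
  isMaxFace? G R F = isDirectedForest? ×-dec rootsExactly?
    where
    edge? : Decidable (Edge F)
    edge? a b = F a b ≟ᵇ true
    isDirectedForest? : Dec (IsDirectedForest G F)
    isDirectedForest? =
      (all? λ a → all? λ b → edge? a b →-dec (G a b ≟ᵇ true)) ×-dec
      (all? λ a → all? λ a′ → all? λ b → edge? a b →-dec (edge? a′ b →-dec (a ≟ a′))) ×-dec
      acyclic? edge?
    rootsExactly? : Dec (RootsExactly F R)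
    rootsExactly? =
      all? λ v → ((R v ≟ᵇ true) →-dec isRoot? F v) ×-dec (isRoot? F v →-dec (R v ≟ᵇ true))

module _ {n : ℕ} {F : EdgeSet n} where

  PathFromTo⇒⋆ : ∀ {a us b} → PathFromTo F a us b → Star (Edge F) a b
  PathFromTo⇒⋆ {us = []}    refl         = ε
  PathFromTo⇒⋆ {us = _ ∷ _} (a→u , u⇝b) = a→u ◅ PathFromTo⇒⋆ u⇝b

  PathFromTo-++⁺ : ∀ us {a b c vs} →
                   PathFromTo F a us b → PathFromTo F b vs c → PathFromTo F a (us ++ vs) c
  PathFromTo-++⁺ []       refl         b⇝c = b⇝c
  PathFromTo-++⁺ (_ ∷ us) (a→u , u⇝b) b⇝c = a→u , PathFromTo-++⁺ us u⇝b b⇝c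

  PathFromTo-∷ʳ⁻ : ∀ us {a w c} → PathFromTo F a (us ∷ʳ w) c →
                   ∃ λ b → PathFromTo F a us b × Edge F b c
  PathFromTo-∷ʳ⁻ []       (a→c , refl) = _ , refl , a→c
  PathFromTo-∷ʳ⁻ (_ ∷ us) (a→u , u⇝c) =
    let b , u⇝b , b→c = PathFromTo-∷ʳ⁻ us u⇝c in b , (a→u , u⇝b) , b→c

  PathFromTo-avoids-successor : Acyclic (Edge F) → ∀ us {a b c} →
                                PathFromTo F a us b → Edge F b c → All (_≢ c) us
  PathFromTo-avoids-successor acyclic []       _         _   = []
  PathFromTo-avoids-successor acyclic (_ ∷ us) (_ , u⇝b) b→c =
    (λ { refl → acyclic _ (b→c ◅⁺ PathFromTo⇒⋆ u⇝b) }) ∷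
    PathFromTo-avoids-successor acyclic us u⇝b b→c

PathFromTo-target-unique : ∀ {n} {F F′ : EdgeSet n} us {a b b′} →
                           PathFromTo F a us b → PathFromTo F′ a us b′ → b ≡ b′
PathFromTo-target-unique []       refl    refl     = refl
PathFromTo-target-unique (_ ∷ us) (_ , p) (_ , p′) = PathFromTo-target-unique us p p′

redirect : ∀ {n} → EdgeSet n → Fin n → Fin n → EdgeSet n
redirect F x y a b = if ⌊ b ≟ y ⌋ then ⌊ a ≟ x ⌋ else F a b

module _ {n : ℕ} {F : EdgeSet n} {x y : Fin n} where

  redirect-≢ : ∀ {a b} → b ≢ y → redirect F x y a b ≡ F a b
  redirect-≢ {b = b} b≢y with b ≟ y
  ... | yes b≡y = contradiction b≡y b≢y
  ... | no _    = refl

  redirect-new : Edge (redirect F x y) x y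
  redirect-new with y ≟ y | x ≟ x
  ... | yes _  | yes _  = refl
  ... | yes _  | no x≢x = contradiction refl x≢x
  ... | no y≢y | _      = contradiction refl y≢y

  redirect-edge : ∀ {a b} → Edge (redirect F x y) a b → (a ≡ x × b ≡ y) ⊎ (b ≢ y × Edge F a b)
  redirect-edge {a} {b} e with b ≟ y | a ≟ x
  ... | yes b≡y | yes a≡x = inj₁ (a≡x , b≡y)
  ... | no b≢y  | _       = inj₂ (b≢y , e)
  redirect-edge () | yes _ | no _

  redirect-⁺ : ∀ {a b} → TransClosure (Edge (redirect F x y)) a b →
               TransClosure (Edge F) a b ⊎ Star (Edge (redirect F x y)) y b
  redirect-⁺ {a} {b} [ a→b ] with redirect-edge {a} {b} a→b
  ... | inj₁ (_ , refl) = inj₂ ε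
  ... | inj₂ (_ , a→b′) = inj₁ [ a→b′ ]
  redirect-⁺ {a} (_∷_ {y = c} a→c c⇝⁺b) with redirect-edge {a} {c} a→c | redirect-⁺ c⇝⁺b
  ... | inj₁ (_ , refl) | _          = inj₂ (⁺⇒⋆ c⇝⁺b)
  ... | inj₂ (_ , a→c′) | inj₁ c⇝⁺b′ = inj₁ (a→c′ ∷ c⇝⁺b′)
  ... | inj₂ _          | inj₂ y⇝b   = inj₂ y⇝b

  PathFromTo-redirect : ∀ {a us b} → All (_≢ y) us →
                        PathFromTo F a us b → PathFromTo (redirect F x y) a us b
  PathFromTo-redirect []            a≡b          = a≡b
  PathFromTo-redirect (u≢y ∷ avoid) (a→u , u⇝b) =
    trans (redirect-≢ u≢y) a→u , PathFromTo-redirect avoid u⇝b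

  redirect-rootsExactly : ∀ {R} → RootsExactly F R → ¬ R y ≡ true → RootsExactly (redirect F x y) R
  redirect-rootsExactly {R} roots y∉R v = R⇒root , root⇒R
    where
    R⇒root : R v ≡ true → IsRoot (redirect F x y) v
    R⇒root v∈R u = trans (redirect-≢ λ v≡y → y∉R (subst _ v≡y v∈R)) (proj₁ (roots v) v∈R u)
    root⇒R : IsRoot (redirect F x y) v → R v ≡ true
    root⇒R root = proj₂ (roots v) λ u → trans (sym (redirect-≢ v≢y)) (root u)
      where
      v≢y : v ≢ y
      v≢y v≡y = root-¬edge {F = redirect F x y} root x
                  (subst (Edge (redirect F x y) x) (sym v≡y) redirect-new)

  redirect-isDirectedForest : ∀ {G r} → IsDirectedForest G F → Edge G x y → IsRoot (redirect F x y) r →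
                              Star (Edge (redirect F x y)) r x → IsDirectedForest G (redirect F x y)
  redirect-isDirectedForest {G} (F⊆G , unique , acyclic) x→y root r⇝x = F′⊆G , unique′ , acyclic′
    where
    F′⊆G : redirect F x y ⊆E G
    F′⊆G a b e with redirect-edge {a} {b} e
    ... | inj₁ (refl , refl) = x→y
    ... | inj₂ (_ , a→b)     = F⊆G a b a→b
    unique′ : UniquePredecessors (Edge (redirect F x y))
    unique′ a a′ b e e′ with redirect-edge {a} {b} e | redirect-edge {a′} {b} e′
    ... | inj₁ (refl , _)    | inj₁ (refl , _)    = refl
    ... | inj₁ (_ , b≡y)     | inj₂ (b≢y , _)     = contradiction b≡y b≢y
    ... | inj₂ (b≢y , _)     | inj₁ (_ , b≡y)     = contradiction b≡y b≢y
    ... | inj₂ (_ , a→b)     | inj₂ (_ , a′→b)    = unique a a′ b a→b a′→b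
    -- A new cycle must enter y, and y descends from the root r through x.
    acyclic′ : Acyclic (Edge (redirect F x y))
    acyclic′ v cycle with redirect-⁺ cycle
    ... | inj₁ old-cycle = acyclic v old-cycle
    ... | inj₂ y⇝v       =
      reachable-off-cycle unique′ (r⇝x ◅◅ redirect-new ◅ y⇝v) (root-off-cycle root) cycle

  redirect-isMaxFace : ∀ {G R r p} → IsMaxFace G R F → Edge G x y → ¬ R y ≡ true → R r ≡ true →
                       PathFromTo F r p x → All (_≢ y) p → IsMaxFace G R (redirect F x y)
  redirect-isMaxFace (forest , roots) x→y y∉R r∈R r⇝x p-avoids-y =
    redirect-isDirectedForest forest x→y (proj₁ (roots′ _) r∈R)
                              (PathFromTo⇒⋆ (PathFromTo-redirect p-avoids-y r⇝x)) ,
    roots′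
    where
    roots′ : RootsExactly (redirect F x y) _
    roots′ = redirect-rootsExactly roots y∉R

  insertEdge-⊆E-redirect : ∀ {H : EdgeSet n} → H ⊆E F → IsRoot H y →
                           insertEdge H x y ⊆E redirect F x y
  insertEdge-⊆E-redirect {H} H⊆F root a b e with insertEdge-edge {F = H} {x} {y} {a} {b} e
  ... | inj₂ (refl , refl) = redirect-new
  ... | inj₁ a→b           =
    trans (redirect-≢ λ { refl → root-¬edge {F = H} root a a→b }) (H⊆F a b a→b)

module _ {n : ℕ} {G : Graph n} {R : VSet n} where

  edge-target-∉R : ∀ {F x y} → IsMaxFace G R F → Edge F x y → ¬ R y ≡ true
  edge-target-∉R {F} (_ , roots) x→y y∈R = root-¬edge {F = F} (proj₁ (roots _) y∈R) _ x→y

  isLeft-parent : ∀ {F₀ x y} → IsMaxFace G R F₀ → Edge F₀ x y → IsLeft G R y → IsLeft G R x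
  isLeft-parent {F₀} {x} {y} m₀ x→y (r , p , left) with initLast p | left F₀ m₀
  ... | []       | root-y , refl = contradiction x→y (root-¬edge {F = F₀} root-y x)
  ... | us ∷ʳ′ _ | _             = r , us , λ F m → proj₁ (left F m) , path-to-x F m
    where
    unique₀ : UniquePredecessors (Edge F₀)
    unique₀ = proj₁ (proj₂ (proj₁ m₀))
    path-to-x : ∀ F → IsMaxFace G R F → PathFromTo F r us x
    path-to-x F m =
      let b  , r⇝b  , _    = PathFromTo-∷ʳ⁻ us (proj₂ (left F m))
          b₀ , r⇝b₀ , b₀→y = PathFromTo-∷ʳ⁻ us (proj₂ (left F₀ m₀))
      in subst (PathFromTo F r us)
               (trans (PathFromTo-target-unique us r⇝b r⇝b₀) (unique₀ b₀ x y b₀→y x→y)) r⇝b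

  isLeft-forced-child : ∀ {x y} → IsLeft G R x → (∀ F → IsMaxFace G R F → Edge F x y) → IsLeft G R y
  isLeft-forced-child {y = y} (r , p , left) forced =
    r , p ∷ʳ y , λ F m → proj₁ (left F m) , PathFromTo-++⁺ p (proj₂ (left F m)) (forced F m , refl)

  other-parent : ∀ {F x y} → IsMaxFace G R F → ¬ R y ≡ true → F x y ≡ false →
                 ∃ λ z → z ≢ x × InDTR G R (λ a b → ⌊ a ≟ z ⌋ ∧ ⌊ b ≟ y ⌋)
  other-parent {F} {x} {y} m y∉R x↛y =
    let z , ¬z↛y = ¬∀⟶∃¬ n (λ u → F u y ≡ false) (λ u → F u y ≟ᵇ false) (y∉R ∘ proj₂ (proj₂ m y))
    in z , (λ { refl → ¬z↛y x↛y }) , F , m , singleton-⊆E (¬-not ¬z↛y)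

  right-child-other-parent : ∀ {F₀ x y} → IsMaxFace G R F₀ → Edge F₀ x y →
                             IsLeft G R x → ¬ IsLeft G R y →
                             ∃ λ z → z ≢ x × InDTR G R (λ a b → ⌊ a ≟ z ⌋ ∧ ⌊ b ≟ y ⌋)
  right-child-other-parent {x = x} {y} m₀ x→y left-x ¬left-y
    with searchable-EdgeSet n
           (λ F≗F′ (m , x↛y) → isMaxFace-resp F≗F′ m , trans (sym (F≗F′ x y)) x↛y)
           (λ F → isMaxFace? G R F ×-dec (F x y ≟ᵇ false))
  ... | yes (_ , m , x↛y) = other-parent m (edge-target-∉R m₀ x→y) x↛y
  ... | no ¬avoid =
    contradiction (isLeft-forced-child left-x λ F m → ¬-not λ x↛y → ¬avoid (F , m , x↛y)) ¬left-y

  insertEdge-InDTR : ∀ {F₀ x y} → IsMaxFace G R F₀ → Edge F₀ x y → IsLeft G R x →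
                     ∀ H → InDTR G R H → IsRoot H y →
                     IsDirectedForest G (insertEdge H x y) × InDTR G R (insertEdge H x y)
  insertEdge-InDTR {F₀} {x} {y} m₀ x→y (r , p , left) H (F , m , H⊆F) root-y =
    isDirectedForest-anti H+xy⊆F′ (proj₁ m′) , redirect F x y , m′ , H+xy⊆F′
    where
    -- The path from r to x is the same in F as in F₀, where it avoids y
    -- because x → y ∈ F₀.
    m′ : IsMaxFace G R (redirect F x y)
    m′ = redirect-isMaxFace m (proj₁ (proj₁ m₀) x y x→y) (edge-target-∉R m₀ x→y)
           (proj₂ (proj₂ m r) (proj₁ (left F m))) (proj₂ (left F m))
           (PathFromTo-avoids-successor (proj₂ (proj₂ (proj₁ m₀))) p (proj₂ (left F₀ m₀)) x→y)
    H+xy⊆F′ : insertEdge H x y ⊆E redirect F x y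
    H+xy⊆F′ = insertEdge-⊆E-redirect H⊆F root-y

proposition2p5 : (n : ℕ) (G : Graph n) (R : VSet n) (x y : Fin n) →
    (∃ λ (F : EdgeSet n) → IsMaxFace G R F × (F x y ≡ true)) →
    ((IsLeft G R x × ¬ IsLeft G R y) ⊎ (¬ IsLeft G R x × IsLeft G R y)) →
    IsNice G R x y
proposition2p5 n G R x y (F₀ , m₀ , x→y) (inj₁ (left-x , ¬left-y)) =
  right-child-other-parent m₀ x→y left-x ¬left-y , insertEdge-InDTR m₀ x→y left-x
proposition2p5 n G R x y (F₀ , m₀ , x→y) (inj₂ (¬left-x , left-y)) =
  contradiction (isLeft-parent m₀ x→y left-y) ¬left-x
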